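{- Let $p=2$. For all $\boldsymbol{\lambda}\in\mathbb{Q}^2$, $$\mathbb{G}_{\boldsymbol{\lambda}}(\tau)=\sum_{\boldsymbol{n}\in\mathbb{N}_0^2}q^{2Q(\boldsymbol{n}+\boldsymbol{\lambda}+(\frac12,\frac12))}-\sum_{n_2>n_1\geq0}q^{2Q(\boldsymbol{n}+\boldsymbol{\lambda}+(\frac12,0))}-\sum_{n_1>n_2\geq0}q^{2Q(\boldsymbol{n}+\boldsymbol{\lambda}+(0,\frac12))}.$$
   Context: For $\tau\in\mathbb{H}$, $q=e^{2\pi i\tau}$, $q^\alpha=e^{2\pi i\alpha\tau}$ for rational $\alpha$. $Q(\boldsymbol{n})=n_1^2+n_2^2-n_1n_2$, $\mathbb{N}=\{1,2,\dots\}$, $\mathbb{N}_0=\{0,1,2,\dots\}$. For $p=2$ and $\boldsymbol{\lambda}\in\mathbb{Q}^2$, \begin{multline*}\mathbb{G}_{\boldsymbol{\lambda}}(\tau):=\sum_{\boldsymbol{n}\in\mathbb{N}^2}\min(n_1,n_2)\,q^{2Q(\boldsymbol{n}+\boldsymbol{\lambda}-(\frac12,\frac12))}\Big(1-q^{2(n_1+\lambda_1)-(n_2+\lambda_2)}-q^{2(n_2+\lambda_2)-(n_1+\lambda_1)}\\+q^{3(n_1+\lambda_1)}+q^{3(n_2+\lambda_2)}-q^{2(n_1+\lambda_1)+2(n_2+\lambda_2)}\Big).\end{multline*} Sums like $\sum_{n_2>n_1\geq0}$ run over $\boldsymbol{n}=(n_1,n_2)\in\mathbb{Z}^2$ with the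 indicated inequalities. -}

module Defs where

open import Data.Nat as ℕ using (ℕ; zero; suc; _≤_; _<_; _<ᵇ_; _⊔_; _⊓_)
open import Data.Integer as ℤ using (ℤ; +_)
open import Data.Rational as ℚ using (ℚ; ½; _+_; _-_; _*_; _/_)
open import Data.Rational.Properties using (_≟_)
open import Data.List using (List; []; _∷_; _++_; foldr; map; upTo)
open import Data.Product using (_×_; _,_; ∃-syntax)
open import Data.Bool using (if_then_else_)
open import Relation.Nullary.Decidable using (does)
open import Relation.Binary.PropositionalEquality using (_≡_)

ℕ→ℚ : ℕ → ℚ
ℕ→ℚ n = + n / 1

two three : ℚ
two = + 2 / 1
three = + 3 / 1

Q : ℚ → ℚ → ℚ
Q x₁ x₂ = x₁ * x₁ + x₂ * x₂ - x₁ * x₂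

-- A (formal) term  c · q^e  with integer coefficient c and rational exponent e.
Term : Set
Term = ℤ × ℚ

-- A lattice q-series: to each index n = (n₁,n₂) ∈ ℕ₀² it assigns the finite
-- list of terms it contributes (empty list for indices outside the summation range).
LSeries : Set
LSeries = ℕ → ℕ → List Term

coeffList : ℚ → List Term → ℤ
coeffList e = foldr (λ { (c , e') acc → if does (e' ≟ e) then c ℤ.+ acc else acc }) (+ 0)

sumℤ : List ℤ → ℤ
sumℤ = foldr ℤ._+_ (+ 0)

coeffBox : LSeries → ℕ → ℚ → ℤ
coeffBox f B e = sumℤ (map (λ n₁ → sumℤ (map (λ n₂ → coeffList e (f n₁ n₂)) (upTo B))) (upTo B))

-- Equality of q-series as formal series in rational powers of q:
-- for every exponent e, the coefficient of q^e agrees (the coefficient being the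
-- finite sum over all lattice indices, reached by every sufficiently large box).
_≐_ : LSeries → LSeries → Set
f ≐ g = ∀ (e : ℚ) → ∃[ B ] (∀ B' → B ≤ B' → coeffBox f B' e ≡ coeffBox g B' e)

𝔾 : ℚ → ℚ → LSeries
𝔾 λ₁ λ₂ zero n₂ = []
𝔾 λ₁ λ₂ (suc k) zero = []
𝔾 λ₁ λ₂ n₁@(suc _) n₂@(suc _) =
    (m , base)
  ∷ (ℤ.- m , base + (two * a - b))
  ∷ (ℤ.- m , base + (two * b - a))
  ∷ (m , base + three * a)
  ∷ (m , base + three * b)
  ∷ (ℤ.- m , base + (two * a + two * b))
  ∷ []
  where
    m : ℤ
    m = + (n₁ ⊓ n₂)
    a b base : ℚ
    a = ℕ→ℚ n₁ + λ₁
    b = ℕ→ℚ n₂ + λ₂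
    base = two * Q (a - ½) (b - ½)

RHS : ℚ → ℚ → LSeries
RHS λ₁ λ₂ n₁ n₂ =
    (+ 1 , two * Q (a + ½) (b + ½))
  ∷ ((if n₁ <ᵇ n₂ then (ℤ.- (+ 1) , two * Q (a + ½) b) ∷ [] else [])
  ++ (if n₂ <ᵇ n₁ then (ℤ.- (+ 1) , two * Q a (b + ½)) ∷ [] else []))
  where
    a b : ℚ
    a = ℕ→ℚ n₁ + λ₁
    b = ℕ→ℚ n₂ + λ₂

{-# OPTIONS --safe #-}
-- Compare the coefficients of q^e inside a large box of indices. Write F, G, H (i, j) for the
-- coefficients of q^e contributed at index (i, j) by the three series on the right. With
-- (a, b) = n + λ, the six exponents in the summand of 𝔾 at n = (i+1, j+1) are 2Q at (a, b) − (½, ½)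
-- shifted by (0,0), (½,0), (0,½), (1,½), (½,1), (1,1), so that summand is 1 + min(i, j) times
--   (F(i,j) − F(i+1,j+1)) − (G(i,j+1) − G(i+1,j+1)) − (H(i+1,j) − H(i+1,j+1)).
-- Summation by parts along columns and rows trades the weight 1 + min(i, j) for its increments,
-- the indicators [i ≤ j] and [j < i]; this turns the three differences into F, [i < j] G and
-- [j < i] H. Boundary terms vanish because 2Q(x, y) ≥ x², so q^e does not occur at large indices.
module Submission where

open import Data.Bool using (Bool; true; false; if_then_else_)
open import Data.Nat as ℕ using (ℕ; zero; suc; _⊓_; _<ᵇ_; s≤s)
import Data.Nat.Properties as ℕP
open import Data.Integer using (ℤ; +_; -[1+_]; 0ℤ; 1ℤ)
open import Data.Rational using (ℚ; mkℚ; ½; 1ℚ)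
open import Data.List using (List; []; _∷_; _++_; map; applyUpTo)
open import Data.Product using (_×_; _,_; proj₁; proj₂; ∃-syntax)
open import Function using (flip)
open import Relation.Binary.PropositionalEquality
open import Relation.Nullary.Decidable using (does; dec-false)

open import Defs

-- Finite sums and summation by parts
module _ where
  open import Data.Integer using (_+_; _-_; _*_; -_)
  open import Data.Integer.Properties
    using ( +-comm; +-assoc; +-identityˡ; +-identityʳ; *-zeroˡ; *-zeroʳ; *-identityˡ; *-distribʳ-+
          ; +-commutativeSemigroup; [1+m]⊖[1+n]≡m⊖n; m-n≡m⊖n)
  open import Data.Integer.Tactic.RingSolver using (solve-∀)
  open import Algebra.Properties.CommutativeSemigroup +-commutativeSemigroup using (interchange)
  open ≡-Reasoning

  𝟙 : Bool → ℤ
  𝟙 b = if b then 1ℤ else 0ℤ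

  *-≡0ʳ : ∀ c {a} → a ≡ 0ℤ → c * a ≡ 0ℤ
  *-≡0ʳ c refl = *-zeroʳ c

  infixl 10 ∑
  ∑ : ℕ → (ℕ → ℤ) → ℤ
  ∑ zero    f = 0ℤ
  ∑ (suc n) f = f 0 + ∑ n (λ i → f (suc i))

  syntax ∑ n (λ i → x) = ∑[ i < n ] x

  ∑-cong : ∀ n {f g : ℕ → ℤ} → (∀ i → f i ≡ g i) → ∑ n f ≡ ∑ n g
  ∑-cong zero    f≗g = refl
  ∑-cong (suc n) f≗g = cong₂ _+_ (f≗g 0) (∑-cong n (λ i → f≗g (suc i)))

  ∑-zero : ∀ n {f : ℕ → ℤ} → (∀ i → f i ≡ 0ℤ) → ∑ n f ≡ 0ℤ
  ∑-zero zero    f≗0 = refl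
  ∑-zero (suc n) f≗0 = cong₂ _+_ (f≗0 0) (∑-zero n (λ i → f≗0 (suc i)))

  ∑-distrib-+ : ∀ n (f g : ℕ → ℤ) → ∑[ i < n ] (f i + g i) ≡ ∑ n f + ∑ n g
  ∑-distrib-+ zero    f g = refl
  ∑-distrib-+ (suc n) f g =
    trans (cong (λ s → (f 0 + g 0) + s) (∑-distrib-+ n _ _)) (interchange (f 0) (g 0) _ _)

  ∑-distrib-− : ∀ n (f g : ℕ → ℤ) → ∑[ i < n ] (f i - g i) ≡ ∑ n f - ∑ n g
  ∑-distrib-− zero    f g = refl
  ∑-distrib-− (suc n) f g =
    trans (cong (λ s → (f 0 - g 0) + s) (∑-distrib-− n _ _)) (interchange-− (f 0) (g 0) _ _)
    where
    interchange-− : ∀ a b c d → (a - b) + (c - d) ≡ (a + c) - (b + d)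
    interchange-− = solve-∀

  ∑-init-last : ∀ n (f : ℕ → ℤ) → ∑ (suc n) f ≡ ∑ n f + f n
  ∑-init-last zero    f = +-comm (f 0) 0ℤ
  ∑-init-last (suc n) f =
    trans (cong (λ s → f 0 + s) (∑-init-last n (λ i → f (suc i)))) (sym (+-assoc (f 0) _ _))

  ∑-last-zero : ∀ n (f : ℕ → ℤ) → f n ≡ 0ℤ → ∑ (suc n) f ≡ ∑ n f
  ∑-last-zero n f fn≡0 =
    trans (∑-init-last n f) (trans (cong (λ s → ∑ n f + s) fn≡0) (+-identityʳ (∑ n f)))

  ∑-head-zero : ∀ n (f : ℕ → ℤ) → f 0 ≡ 0ℤ → ∑ (suc n) f ≡ ∑[ i < n ] f (suc i)
  ∑-head-zero n f f0≡0 = trans (cong (_+ ∑[ i < n ] f (suc i)) f0≡0) (+-identityˡ _)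

  ∑-comm : ∀ n m (f : ℕ → ℕ → ℤ) → ∑[ i < n ] ∑[ j < m ] f i j ≡ ∑[ j < m ] ∑[ i < n ] f i j
  ∑-comm zero    m f = sym (∑-zero m (λ _ → refl))
  ∑-comm (suc n) m f =
    trans (cong (λ s → ∑ m (f 0) + s) (∑-comm n m (λ i → f (suc i)))) (sym (∑-distrib-+ m _ _))

  ∑-by-parts : ∀ n (W g : ℕ → ℤ) → W 0 ≡ 0ℤ →
    ∑[ i < n ] (W (suc i) * (g i - g (suc i))) ≡ ∑[ i < n ] ((W (suc i) - W i) * g i) - W n * g n
  ∑-by-parts zero    W g W0≡0 rewrite W0≡0 | *-zeroˡ (g 0) = refl
  ∑-by-parts (suc n) W g W0≡0 = begin
      ∑[ i < suc n ] (W (suc i) * (g i - g (suc i)))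
    ≡⟨ ∑-init-last n _ ⟩
      ∑[ i < n ] (W (suc i) * (g i - g (suc i))) + W (suc n) * (g n - g (suc n))
    ≡⟨ cong (_+ W (suc n) * (g n - g (suc n))) (∑-by-parts n W g W0≡0) ⟩
      ∑[ i < n ] ((W (suc i) - W i) * g i) - W n * g n + W (suc n) * (g n - g (suc n))
    ≡⟨ regroup (∑[ i < n ] ((W (suc i) - W i) * g i)) (W n) (W (suc n)) (g n) (g (suc n)) ⟩
      ∑[ i < n ] ((W (suc i) - W i) * g i) + (W (suc n) - W n) * g n - W (suc n) * g (suc n)
    ≡⟨ cong (_- W (suc n) * g (suc n)) (∑-init-last n _) ⟨
      ∑[ i < suc n ] ((W (suc i) - W i) * g i) - W (suc n) * g (suc n) ∎
    where
    regroup : ∀ s w w′ x x′ → s - w * x + w′ * (x - x′) ≡ s + (w′ - w) * x - w′ * x′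
    regroup = solve-∀

  ⊓-increment : ∀ i j → + (suc i ⊓ j) - + (i ⊓ j) ≡ 𝟙 (i <ᵇ j)
  ⊓-increment zero    zero    = refl
  ⊓-increment zero    (suc j) = refl
  ⊓-increment (suc i) zero    = refl
  ⊓-increment (suc i) (suc j) =
    trans ([1+m]⊖[1+n]≡m⊖n (suc i ⊓ j) (i ⊓ j))
          (trans (sym (m-n≡m⊖n (suc i ⊓ j) (i ⊓ j))) (⊓-increment i j))

  ∑-min-weight-by-parts : ∀ n j (g : ℕ → ℤ) → g n ≡ 0ℤ →
    ∑[ i < n ] (+ suc (i ⊓ j) * (g i - g (suc i))) ≡ ∑[ i < n ] (𝟙 (i <ᵇ suc j) * g i)
  ∑-min-weight-by-parts n j g gn≡0 = begin
      ∑[ i < n ] (+ suc (i ⊓ j) * (g i - g (suc i)))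
    ≡⟨ ∑-by-parts n W g refl ⟩
      ∑[ i < n ] ((W (suc i) - W i) * g i) - W n * g n
    ≡⟨ cong₂ _-_ (∑-cong n (λ i → cong (_* g i) (⊓-increment i (suc j)))) (*-≡0ʳ (W n) gn≡0) ⟩
      ∑[ i < n ] (𝟙 (i <ᵇ suc j) * g i) - 0ℤ
    ≡⟨ +-identityʳ _ ⟩
      ∑[ i < n ] (𝟙 (i <ᵇ suc j) * g i) ∎
    where
    -- W (suc i) reduces to the weight + suc (i ⊓ j).
    W : ℕ → ℤ
    W k = + (k ⊓ suc j)

  ∑² : ℕ → (ℕ → ℕ → ℤ) → ℤ
  ∑² n f = ∑[ i < n ] ∑[ j < n ] f i j

  ∑²-cong : ∀ n {f g : ℕ → ℕ → ℤ} → (∀ i j → f i j ≡ g i j) → ∑² n f ≡ ∑² n g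
  ∑²-cong n f≗g = ∑-cong n (λ i → ∑-cong n (f≗g i))

  ∑²-distrib-+ : ∀ n (f g : ℕ → ℕ → ℤ) → ∑² n (λ i j → f i j + g i j) ≡ ∑² n f + ∑² n g
  ∑²-distrib-+ n f g = trans (∑-cong n (λ i → ∑-distrib-+ n (f i) (g i))) (∑-distrib-+ n _ _)

  ∑²-distrib-− : ∀ n (f g : ℕ → ℕ → ℤ) → ∑² n (λ i j → f i j - g i j) ≡ ∑² n f - ∑² n g
  ∑²-distrib-− n f g = trans (∑-cong n (λ i → ∑-distrib-− n (f i) (g i))) (∑-distrib-− n _ _)

  ∑²-distrib-−₃ : ∀ n (f g h : ℕ → ℕ → ℤ) →
    ∑² n (λ i j → f i j - g i j - h i j) ≡ ∑² n f - ∑² n g - ∑² n h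
  ∑²-distrib-−₃ n f g h =
    trans (∑²-distrib-− n _ h) (cong (_- ∑² n h) (∑²-distrib-− n f g))

  ∑²-transpose : ∀ n (f : ℕ → ℕ → ℤ) → ∑² n f ≡ ∑² n (flip f)
  ∑²-transpose n = ∑-comm n n

  ∑²-drop-last : ∀ n (f : ℕ → ℕ → ℤ) → (∀ j → f n j ≡ 0ℤ) → (∀ i → f i n ≡ 0ℤ) →
    ∑² (suc n) f ≡ ∑² n f
  ∑²-drop-last n f row col =
    trans (∑-last-zero n (λ i → ∑ (suc n) (f i)) (∑-zero (suc n) row)) (∑-cong n (λ i → ∑-last-zero n (f i) (col i)))

  ∑²-drop-first : ∀ n (f : ℕ → ℕ → ℤ) → (∀ j → f 0 j ≡ 0ℤ) → (∀ i → f (suc i) 0 ≡ 0ℤ) →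
    ∑² (suc n) f ≡ ∑² n (λ i j → f (suc i) (suc j))
  ∑²-drop-first n f row col =
    trans (∑-head-zero n (λ i → ∑ (suc n) (f i)) (∑-zero (suc n) row)) (∑-cong n (λ i → ∑-head-zero n (f (suc i)) (col i)))

  ∑²-min-weight-by-parts : ∀ n (g : ℕ → ℕ → ℤ) → (∀ j → g n j ≡ 0ℤ) →
    ∑² n (λ i j → + suc (i ⊓ j) * (g i j - g (suc i) j)) ≡ ∑² n (λ i j → 𝟙 (i <ᵇ suc j) * g i j)
  ∑²-min-weight-by-parts n g row =
    trans (∑²-transpose n _)
          (trans (∑-cong n (λ j → ∑-min-weight-by-parts n j (λ i → g i j) (row j)))
                 (∑²-transpose n _))

  upper-by-parts : ∀ n (G : ℕ → ℕ → ℤ) → (∀ j → G n j ≡ 0ℤ) →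
    ∑² n (λ i j → + suc (i ⊓ j) * (G i (suc j) - G (suc i) (suc j)))
      ≡ ∑² (suc n) (λ i j → 𝟙 (i <ᵇ j) * G i j)
  upper-by-parts n G row = begin
      ∑² n (λ i j → + suc (i ⊓ j) * (G i (suc j) - G (suc i) (suc j)))
    ≡⟨ ∑²-min-weight-by-parts n (λ i j → G i (suc j)) (λ j → row (suc j)) ⟩
      ∑² n (λ i j → 𝟙 (i <ᵇ suc j) * G i (suc j))
    ≡⟨ ∑-cong n (λ i → ∑-head-zero n (λ j → 𝟙 (i <ᵇ j) * G i j) (*-zeroˡ (G i 0))) ⟨
      ∑[ i < n ] ∑[ j < suc n ] (𝟙 (i <ᵇ j) * G i j)
    ≡⟨ ∑-last-zero n (λ i → ∑[ j < suc n ] (𝟙 (i <ᵇ j) * G i j))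
                   (∑-zero (suc n) (λ j → *-≡0ʳ (𝟙 (n <ᵇ j)) (row j))) ⟨
      ∑² (suc n) (λ i j → 𝟙 (i <ᵇ j) * G i j) ∎

  lower-by-parts : ∀ n (H : ℕ → ℕ → ℤ) → (∀ i → H i n ≡ 0ℤ) →
    ∑² n (λ i j → + suc (i ⊓ j) * (H (suc i) j - H (suc i) (suc j)))
      ≡ ∑² (suc n) (λ i j → 𝟙 (j <ᵇ i) * H i j)
  lower-by-parts n H col = begin
      ∑² n (λ i j → + suc (i ⊓ j) * (H (suc i) j - H (suc i) (suc j)))
    ≡⟨ ∑²-transpose n _ ⟩
      ∑² n (λ i j → + suc (j ⊓ i) * (H (suc j) i - H (suc j) (suc i)))
    ≡⟨ ∑²-cong n (λ i j → cong (λ k → + suc k * (H (suc j) i - H (suc j) (suc i))) (ℕP.⊓-comm j i)) ⟩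
      ∑² n (λ i j → + suc (i ⊓ j) * (flip H i (suc j) - flip H (suc i) (suc j)))
    ≡⟨ upper-by-parts n (flip H) col ⟩
      ∑² (suc n) (λ i j → 𝟙 (i <ᵇ j) * H j i)
    ≡⟨ ∑²-transpose (suc n) (λ i j → 𝟙 (i <ᵇ j) * H j i) ⟩
      ∑² (suc n) (λ i j → 𝟙 (j <ᵇ i) * H i j) ∎

  𝟙-<ᵇ-suc-complement : ∀ i j → 𝟙 (i <ᵇ suc j) + 𝟙 (j <ᵇ i) ≡ 1ℤ
  𝟙-<ᵇ-suc-complement zero    zero    = refl
  𝟙-<ᵇ-suc-complement zero    (suc j) = refl
  𝟙-<ᵇ-suc-complement (suc i) zero    = refl
  𝟙-<ᵇ-suc-complement (suc i) (suc j) = 𝟙-<ᵇ-suc-complement i j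

  diagonal-by-parts : ∀ n (F : ℕ → ℕ → ℤ) → (∀ j → F n j ≡ 0ℤ) → (∀ i → F i n ≡ 0ℤ) →
    ∑² n (λ i j → + suc (i ⊓ j) * (F i j - F (suc i) (suc j))) ≡ ∑² (suc n) F
  diagonal-by-parts n F row col = begin
      ∑² n (λ i j → w i j * (F i j - F (suc i) (suc j)))
    ≡⟨ ∑²-cong n (λ i j → split (w i j) (F i j) (F (suc i) j) (F (suc i) (suc j))) ⟩
      ∑² n (λ i j → w i j * (F i j - F (suc i) j) + w i j * (F (suc i) j - F (suc i) (suc j)))
    ≡⟨ ∑²-distrib-+ n _ _ ⟩
      ∑² n (λ i j → w i j * (F i j - F (suc i) j))
        + ∑² n (λ i j → w i j * (F (suc i) j - F (suc i) (suc j)))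
    ≡⟨ cong₂ _+_ (∑²-min-weight-by-parts n F row) (lower-by-parts n F col) ⟩
      ∑² n on-or-above + ∑² (suc n) below
    ≡⟨ cong (_+ ∑² (suc n) below)
            (∑²-drop-last n on-or-above (λ j → *-≡0ʳ (𝟙 (n <ᵇ suc j)) (row j)) (λ i → *-≡0ʳ (𝟙 (i <ᵇ suc n)) (col i))) ⟨
      ∑² (suc n) on-or-above + ∑² (suc n) below
    ≡⟨ ∑²-distrib-+ (suc n) on-or-above below ⟨
      ∑² (suc n) (λ i j → on-or-above i j + below i j)
    ≡⟨ ∑²-cong (suc n) (λ i j → trans (sym (*-distribʳ-+ (F i j) (𝟙 (i <ᵇ suc j)) (𝟙 (j <ᵇ i))))
                                      (trans (cong (_* F i j) (𝟙-<ᵇ-suc-complement i j)) (*-identityˡ (F i j)))) ⟩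
      ∑² (suc n) F ∎
    where
    w on-or-above below : ℕ → ℕ → ℤ
    w i j = + suc (i ⊓ j)
    on-or-above i j = 𝟙 (i <ᵇ suc j) * F i j
    below i j = 𝟙 (j <ᵇ i) * F i j
    split : ∀ w a b c → w * (a - c) ≡ w * (a - b) + w * (b - c)
    split = solve-∀

  -- With F, G, H the coefficients of q^e in the three series of RHS, 𝔾-summand F G H i j is the
  -- coefficient of q^e in the summand of 𝔾 at index (i + 1, j + 1).
  𝔾-summand : (F G H : ℕ → ℕ → ℤ) → ℕ → ℕ → ℤ
  𝔾-summand F G H i j =
    + suc (i ⊓ j) * (F i j - F (suc i) (suc j))
    - + suc (i ⊓ j) * (G i (suc j) - G (suc i) (suc j))
    - + suc (i ⊓ j) * (H (suc i) j - H (suc i) (suc j))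

  RHS-summand : (F G H : ℕ → ℕ → ℤ) → ℕ → ℕ → ℤ
  RHS-summand F G H i j = F i j - 𝟙 (i <ᵇ j) * G i j - 𝟙 (j <ᵇ i) * H i j

  ∑²-𝔾-summand≡∑²-RHS-summand : ∀ n (F G H : ℕ → ℕ → ℤ) →
    (∀ j → F n j ≡ 0ℤ) → (∀ i → F i n ≡ 0ℤ) → (∀ j → G n j ≡ 0ℤ) → (∀ i → H i n ≡ 0ℤ) →
    ∑² n (𝔾-summand F G H) ≡ ∑² (suc n) (RHS-summand F G H)
  ∑²-𝔾-summand≡∑²-RHS-summand n F G H F-row F-col G-row H-col = begin
      ∑² n (𝔾-summand F G H)
    ≡⟨ ∑²-distrib-−₃ n _ _ _ ⟩
      ∑² n (λ i j → + suc (i ⊓ j) * (F i j - F (suc i) (suc j)))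
        - ∑² n (λ i j → + suc (i ⊓ j) * (G i (suc j) - G (suc i) (suc j)))
        - ∑² n (λ i j → + suc (i ⊓ j) * (H (suc i) j - H (suc i) (suc j)))
    ≡⟨ cong₂ _-_ (cong₂ _-_ (diagonal-by-parts n F F-row F-col) (upper-by-parts n G G-row))
                 (lower-by-parts n H H-col) ⟩
      ∑² (suc n) F
        - ∑² (suc n) (λ i j → 𝟙 (i <ᵇ j) * G i j)
        - ∑² (suc n) (λ i j → 𝟙 (j <ᵇ i) * H i j)
    ≡⟨ ∑²-distrib-−₃ (suc n) F (λ i j → 𝟙 (i <ᵇ j) * G i j) (λ i j → 𝟙 (j <ᵇ i) * H i j) ⟨
      ∑² (suc n) (RHS-summand F G H) ∎

-- Estimates and identities in ℚ
module _ where
  open import Data.Nat.Coprimality using (1-coprimeTo) renaming (sym to coprime-sym)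
  open import Data.Integer as ℤ using (-≤+; +≤+)
  import Data.Integer.Properties as ℤP
  open import Data.Rational using (_+_; _-_; _*_; _/_; _≤_; _<_; _⊔_; 0ℚ; *≤*; nonNegative; nonPositive)
  open import Data.Rational.Properties
  open import Data.Rational.Solver using (module +-*-Solver)
  open +-*-Solver using (solve; Polynomial; _:+_; _:*_; _:-_; _:=_; con)
  open import Data.Sum using (inj₁; inj₂)

  ℕ→ℚ≡mkℚ : ∀ n → ℕ→ℚ n ≡ mkℚ (+ n) 0 (coprime-sym (1-coprimeTo n))
  ℕ→ℚ≡mkℚ n = normalize-coprime (coprime-sym (1-coprimeTo n))

  ℕ→ℚ-suc : ∀ n → ℕ→ℚ (suc n) ≡ ℕ→ℚ n + 1ℚ
  ℕ→ℚ-suc n = begin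
      + suc n / 1
    ≡⟨ cong (_/ 1) (trans (ℤP.+-comm 1ℤ (+ n)) (cong (ℤ._+ 1ℤ) (sym (ℤP.*-identityʳ (+ n))))) ⟩
      (+ n ℤ.* 1ℤ ℤ.+ 1ℤ ℤ.* 1ℤ) / 1
    ≡⟨ cong₂ _+_ (ℕ→ℚ≡mkℚ n) (ℕ→ℚ≡mkℚ 1) ⟨
      ℕ→ℚ n + 1ℚ ∎
    where open ≡-Reasoning

  ℕ→ℚ-mono-≤ : ∀ {m n} → m ℕ.≤ n → ℕ→ℚ m ≤ ℕ→ℚ n
  ℕ→ℚ-mono-≤ {m} {n} m≤n rewrite ℕ→ℚ≡mkℚ m | ℕ→ℚ≡mkℚ n =
    *≤* (subst₂ ℤ._≤_ (sym (ℤP.*-identityʳ (+ m))) (sym (ℤP.*-identityʳ (+ n))) (+≤+ m≤n))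

  ℕ→ℚ-unbounded : ∀ p → ∃[ k ] p ≤ ℕ→ℚ k
  ℕ→ℚ-unbounded p@(mkℚ (+ k) d _) = k , subst (p ≤_) (sym (ℕ→ℚ≡mkℚ k))
    (*≤* (subst₂ ℤ._≤_ (sym (ℤP.*-identityʳ (+ k))) (ℤP.pos-* k (suc d)) (+≤+ (ℕP.m≤m*n k (suc d)))))
  ℕ→ℚ-unbounded p@(mkℚ -[1+ k ] d _) = 0 , subst (p ≤_) (sym (ℕ→ℚ≡mkℚ 0))
    (*≤* (subst (ℤ._≤ 0ℤ ℤ.* + suc d) (sym (ℤP.*-identityʳ -[1+ k ])) -≤+))

  eventually-above : ∀ t c → ∃[ N ] (∀ n → N ℕ.≤ n → t < ℕ→ℚ n + c + ½)
  eventually-above t c = N , λ n N≤n → begin-strict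
      t              <⟨ subst (_< t + ½) (+-identityʳ t) (+-monoʳ-< t (positive⁻¹ ½)) ⟩
      t + ½          ≡⟨ solve 2 (λ t c → t :+ con ½ := t :- c :+ c :+ con ½) refl t c ⟩
      t - c + c + ½  ≤⟨ +-monoˡ-≤ ½ (+-monoˡ-≤ c (≤-trans (proj₂ (ℕ→ℚ-unbounded (t - c))) (ℕ→ℚ-mono-≤ N≤n))) ⟩
      ℕ→ℚ n + c + ½  ∎
    where
    open ≤-Reasoning
    N : ℕ
    N = proj₁ (ℕ→ℚ-unbounded (t - c))

  0≤p*p : ∀ p → 0ℚ ≤ p * p
  0≤p*p p with ≤-total 0ℚ p
  ... | inj₁ 0≤p = nonNegative⁻¹ _ {{nonNeg*nonNeg⇒nonNeg p {{nonNegative 0≤p}} p {{nonNegative 0≤p}}}}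
  ... | inj₂ p≤0 = nonNegative⁻¹ _ {{nonPos*nonPos⇒nonPos p {{nonPositive p≤0}} p {{nonPositive p≤0}}}}

  p≤p*p : ∀ {p} → 1ℚ ≤ p → p ≤ p * p
  p≤p*p {p} 1≤p = subst (_≤ p * p) (*-identityʳ p)
    (*-monoˡ-≤-nonNeg p {{nonNegative (≤-trans (<⇒≤ (positive⁻¹ 1ℚ)) 1≤p)}} 1≤p)

  p≤p+q : ∀ p {q} → 0ℚ ≤ q → p ≤ p + q
  p≤p+q p 0≤q = subst (_≤ p + _) (+-identityʳ p) (+-monoʳ-≤ p 0≤q)

  Q̂ : ∀ {n} → Polynomial n → Polynomial n → Polynomial n
  Q̂ x y = x :* x :+ y :* y :- x :* y

  Q-comm : ∀ x y → Q x y ≡ Q y x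
  Q-comm = solve 2 (λ x y → Q̂ x y := Q̂ y x) refl

  two*Q≡sum-of-squares : ∀ x y → two * Q x y ≡ x * x + (y * y + (x - y) * (x - y))
  two*Q≡sum-of-squares =
    solve 2 (λ x y → con two :* Q̂ x y := x :* x :+ (y :* y :+ (x :- y) :* (x :- y))) refl

  <-two*Q : ∀ {t x} y → 1ℚ ⊔ t < x → t < two * Q x y
  <-two*Q {t} {x} y 1⊔t<x = begin-strict
      t                                    ≤⟨ p≤q⊔p 1ℚ t ⟩
      1ℚ ⊔ t                               <⟨ 1⊔t<x ⟩
      x                                    ≤⟨ p≤p*p (≤-trans (p≤p⊔q 1ℚ t) (<⇒≤ 1⊔t<x)) ⟩
      x * x                                ≤⟨ p≤p+q (x * x) (≤-trans (0≤p*p y) (p≤p+q (y * y) (0≤p*p (x - y)))) ⟩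
      x * x + (y * y + (x - y) * (x - y))  ≡⟨ two*Q≡sum-of-squares x y ⟨
      two * Q x y                          ∎
    where open ≤-Reasoning

  ℕ→ℚ-suc-+-½ : ∀ n c → ℕ→ℚ (suc n) + c - ½ ≡ ℕ→ℚ n + c + ½
  ℕ→ℚ-suc-+-½ n c = trans (cong (λ u → u + c - ½) (ℕ→ℚ-suc n))
    (solve 2 (λ u c → u :+ con 1ℚ :+ c :- con ½ := u :+ c :+ con ½) refl (ℕ→ℚ n) c)

  two*Q[a,b-½] : ∀ a b → two * Q (a - ½) (b - ½) + (two * a - b) ≡ two * Q a (b - ½)
  two*Q[a,b-½] = solve 2 (λ a b →
    con two :* Q̂ (a :- con ½) (b :- con ½) :+ (con two :* a :- b) := con two :* Q̂ a (b :- con ½)) refl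

  two*Q[a-½,b] : ∀ a b → two * Q (a - ½) (b - ½) + (two * b - a) ≡ two * Q (a - ½) b
  two*Q[a-½,b] = solve 2 (λ a b →
    con two :* Q̂ (a :- con ½) (b :- con ½) :+ (con two :* b :- a) := con two :* Q̂ (a :- con ½) b) refl

  two*Q[a+½,b] : ∀ a b → two * Q (a - ½) (b - ½) + three * a ≡ two * Q (a + ½) b
  two*Q[a+½,b] = solve 2 (λ a b →
    con two :* Q̂ (a :- con ½) (b :- con ½) :+ con three :* a := con two :* Q̂ (a :+ con ½) b) refl

  two*Q[a,b+½] : ∀ a b → two * Q (a - ½) (b - ½) + three * b ≡ two * Q a (b + ½)
  two*Q[a,b+½] = solve 2 (λ a b →
    con two :* Q̂ (a :- con ½) (b :- con ½) :+ con three :* b := con two :* Q̂ a (b :+ con ½)) refl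

  two*Q[a+½,b+½] : ∀ a b → two * Q (a - ½) (b - ½) + (two * a + two * b) ≡ two * Q (a + ½) (b + ½)
  two*Q[a+½,b+½] = solve 2 (λ a b →
    con two :* Q̂ (a :- con ½) (b :- con ½) :+ (con two :* a :+ con two :* b)
      := con two :* Q̂ (a :+ con ½) (b :+ con ½)) refl

-- Coefficients of q-series
module _ where
  open import Data.Rational using (_<_; _⊔_; _*_)
  open import Data.Rational.Properties using (_≟_; <-irrefl)

  δ : ℚ → ℚ → ℤ
  δ e x = 𝟙 (does (x ≟ e))

  δ-vanishes : ∀ {e x} → e < x → δ e x ≡ 0ℤ
  δ-vanishes {e} {x} e<x = cong 𝟙 (dec-false (x ≟ e) (λ x≡e → <-irrefl (sym x≡e) e<x))

  δ-two*Q-vanishesˡ : ∀ {e u} v → 1ℚ ⊔ e < u → δ e (two * Q u v) ≡ 0ℤ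
  δ-two*Q-vanishesˡ v 1⊔e<u = δ-vanishes (<-two*Q v 1⊔e<u)

  δ-two*Q-vanishesʳ : ∀ {e} u {v} → 1ℚ ⊔ e < v → δ e (two * Q u v) ≡ 0ℤ
  δ-two*Q-vanishesʳ {e} u {v} 1⊔e<v =
    trans (cong (λ q → δ e (two * q)) (Q-comm u v)) (δ-two*Q-vanishesˡ u 1⊔e<v)

module _ where
  open import Data.Integer using (_+_; _*_)
  open import Data.Integer.Properties using (*-identityʳ; *-identityˡ; *-zeroʳ; *-zeroˡ; +-identityˡ; +-assoc)
  open import Data.Rational.Properties using (_≟_)
  open ≡-Reasoning

  contribution : ℚ → Term → ℤ
  contribution e (c , x) = c * δ e x

  coeffList-∷ : ∀ e c x ts → coeffList e ((c , x) ∷ ts) ≡ c * δ e x + coeffList e ts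
  coeffList-∷ e c x ts with does (x ≟ e)
  ... | true  = cong (_+ coeffList e ts) (sym (*-identityʳ c))
  ... | false = sym (trans (cong (_+ coeffList e ts) (*-zeroʳ c)) (+-identityˡ _))

  coeffList-linear : ∀ e ts → coeffList e ts ≡ sumℤ (map (contribution e) ts)
  coeffList-linear e []             = refl
  coeffList-linear e ((c , x) ∷ ts) =
    trans (coeffList-∷ e c x ts) (cong (λ s → c * δ e x + s) (coeffList-linear e ts))

  coeffList-++ : ∀ e ts us → coeffList e (ts ++ us) ≡ coeffList e ts + coeffList e us
  coeffList-++ e []             us = sym (+-identityˡ _)
  coeffList-++ e ((c , x) ∷ ts) us = begin
      coeffList e ((c , x) ∷ ts ++ us)
    ≡⟨ coeffList-∷ e c x (ts ++ us) ⟩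
      c * δ e x + coeffList e (ts ++ us)
    ≡⟨ cong (λ s → c * δ e x + s) (coeffList-++ e ts us) ⟩
      c * δ e x + (coeffList e ts + coeffList e us)
    ≡⟨ +-assoc (c * δ e x) _ _ ⟨
      c * δ e x + coeffList e ts + coeffList e us
    ≡⟨ cong (_+ coeffList e us) (coeffList-∷ e c x ts) ⟨
      coeffList e ((c , x) ∷ ts) + coeffList e us ∎

  coeffList-if : ∀ e b ts → coeffList e (if b then ts else []) ≡ 𝟙 b * coeffList e ts
  coeffList-if e true  ts = sym (*-identityˡ (coeffList e ts))
  coeffList-if e false ts = sym (*-zeroˡ (coeffList e ts))

  sumℤ-applyUpTo : ∀ n (g : ℕ → ℤ) (h : ℕ → ℕ) → sumℤ (map g (applyUpTo h n)) ≡ ∑[ k < n ] g (h k)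
  sumℤ-applyUpTo zero    g h = refl
  sumℤ-applyUpTo (suc n) g h = cong (λ s → g (h 0) + s) (sumℤ-applyUpTo n g (λ k → h (suc k)))

  coeffBox-∑² : ∀ f n e → coeffBox f n e ≡ ∑² n (λ i j → coeffList e (f i j))
  coeffBox-∑² f n e =
    trans (sumℤ-applyUpTo n _ (λ k → k)) (∑-cong n (λ i → sumℤ-applyUpTo n _ (λ k → k)))

module Coefficients (λ₁ λ₂ e : ℚ) where
  import Data.Rational as ℚ
  open import Data.Integer using (_+_; _-_; _*_; -_)
  open import Data.Integer.Tactic.RingSolver using (solve-∀)
  open ≡-Reasoning

  a b : ℕ → ℚ
  a i = ℕ→ℚ i ℚ.+ λ₁
  b j = ℕ→ℚ j ℚ.+ λ₂

  F G H : ℕ → ℕ → ℤ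
  F i j = δ e (two ℚ.* Q (a i ℚ.+ ½) (b j ℚ.+ ½))
  G i j = δ e (two ℚ.* Q (a i ℚ.+ ½) (b j))
  H i j = δ e (two ℚ.* Q (a i) (b j ℚ.+ ½))

  a-suc-½ : ∀ i → a (suc i) ℚ.- ½ ≡ a i ℚ.+ ½
  a-suc-½ i = ℕ→ℚ-suc-+-½ i λ₁

  b-suc-½ : ∀ j → b (suc j) ℚ.- ½ ≡ b j ℚ.+ ½
  b-suc-½ j = ℕ→ℚ-suc-+-½ j λ₂

  𝔾-coefficient : ∀ i j → coeffList e (𝔾 λ₁ λ₂ (suc i) (suc j)) ≡ 𝔾-summand F G H i j
  𝔾-coefficient i j =
    trans (coeffList-linear e (𝔾 λ₁ λ₂ (suc i) (suc j)))
      (trans (weighted-cong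
                (cong (δ e) (cong₂ (λ u v → two ℚ.* Q u v) (a-suc-½ i) (b-suc-½ j)))
                (cong (δ e) (trans (two*Q[a,b-½] A B) (cong (λ v → two ℚ.* Q A v) (b-suc-½ j))))
                (cong (δ e) (trans (two*Q[a-½,b] A B) (cong (λ u → two ℚ.* Q u B) (a-suc-½ i))))
                (cong (δ e) (two*Q[a+½,b] A B))
                (cong (δ e) (two*Q[a,b+½] A B))
                (cong (δ e) (two*Q[a+½,b+½] A B)))
             (regroup m (F i j) (H (suc i) j) (G i (suc j)) (G (suc i) (suc j)) (H (suc i) (suc j)) (F (suc i) (suc j))))
    where
    m : ℤ
    m = + suc (i ⊓ j)
    A B : ℚ
    A = a (suc i)
    B = b (suc j)
    weighted : ℤ → ℤ → ℤ → ℤ → ℤ → ℤ → ℤ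
    weighted f₀₀ h₁₀ g₀₁ g₁₁ h₁₁ f₁₁ =
      m * f₀₀ + (- m * h₁₀ + (- m * g₀₁ + (m * g₁₁ + (m * h₁₁ + (- m * f₁₁ + 0ℤ)))))
    -- Substituting the δ-values by congruence avoids `rewrite`, which normalises the rational exponents.
    weighted-cong : ∀ {f₀₀ h₁₀ g₀₁ g₁₁ h₁₁ f₁₁ f₀₀′ h₁₀′ g₀₁′ g₁₁′ h₁₁′ f₁₁′} →
      f₀₀ ≡ f₀₀′ → h₁₀ ≡ h₁₀′ → g₀₁ ≡ g₀₁′ → g₁₁ ≡ g₁₁′ → h₁₁ ≡ h₁₁′ → f₁₁ ≡ f₁₁′ →
      weighted f₀₀ h₁₀ g₀₁ g₁₁ h₁₁ f₁₁ ≡ weighted f₀₀′ h₁₀′ g₀₁′ g₁₁′ h₁₁′ f₁₁′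
    weighted-cong refl refl refl refl refl refl = refl
    regroup : ∀ m f₀₀ h₁₀ g₀₁ g₁₁ h₁₁ f₁₁ →
      m * f₀₀ + (- m * h₁₀ + (- m * g₀₁ + (m * g₁₁ + (m * h₁₁ + (- m * f₁₁ + 0ℤ)))))
        ≡ m * (f₀₀ - f₁₁) - m * (g₀₁ - g₁₁) - m * (h₁₀ - h₁₁)
    regroup = solve-∀

  RHS-coefficient : ∀ i j → coeffList e (RHS λ₁ λ₂ i j) ≡ RHS-summand F G H i j
  RHS-coefficient i j = begin
      coeffList e (RHS λ₁ λ₂ i j)
    ≡⟨ coeffList-∷ e 1ℤ (two ℚ.* Q (a i ℚ.+ ½) (b j ℚ.+ ½)) (above ++ below) ⟩
      1ℤ * F i j + coeffList e (above ++ below)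
    ≡⟨ cong (λ s → 1ℤ * F i j + s) (coeffList-++ e above below) ⟩
      1ℤ * F i j + (coeffList e above + coeffList e below)
    ≡⟨ cong (λ s → 1ℤ * F i j + s) (cong₂ _+_ (single (i <ᵇ j) G-term) (single (j <ᵇ i) H-term)) ⟩
      1ℤ * F i j + (𝟙 (i <ᵇ j) * (- 1ℤ * G i j + 0ℤ) + 𝟙 (j <ᵇ i) * (- 1ℤ * H i j + 0ℤ))
    ≡⟨ regroup (F i j) (G i j) (H i j) (𝟙 (i <ᵇ j)) (𝟙 (j <ᵇ i)) ⟩
      RHS-summand F G H i j ∎
    where
    G-term H-term : Term
    G-term = - 1ℤ , two ℚ.* Q (a i ℚ.+ ½) (b j)
    H-term = - 1ℤ , two ℚ.* Q (a i) (b j ℚ.+ ½)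
    above below : List Term
    above = if i <ᵇ j then G-term ∷ [] else []
    below = if j <ᵇ i then H-term ∷ [] else []
    single : ∀ c t → coeffList e (if c then t ∷ [] else []) ≡ 𝟙 c * (contribution e t + 0ℤ)
    single c t = trans (coeffList-if e c (t ∷ [])) (cong (𝟙 c *_) (coeffList-linear e (t ∷ [])))
    regroup : ∀ f g h u v → 1ℤ * f + (u * (- 1ℤ * g + 0ℤ) + v * (- 1ℤ * h + 0ℤ)) ≡ f - u * g - v * h
    regroup = solve-∀

  𝔾-coeffBox : ∀ n → coeffBox (𝔾 λ₁ λ₂) (suc n) e ≡ ∑² n (𝔾-summand F G H)
  𝔾-coeffBox n = begin
      coeffBox (𝔾 λ₁ λ₂) (suc n) e
    ≡⟨ coeffBox-∑² (𝔾 λ₁ λ₂) (suc n) e ⟩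
      ∑² (suc n) (λ i j → coeffList e (𝔾 λ₁ λ₂ i j))
    ≡⟨ ∑²-drop-first n (λ i j → coeffList e (𝔾 λ₁ λ₂ i j)) (λ _ → refl) (λ _ → refl) ⟩
      ∑² n (λ i j → coeffList e (𝔾 λ₁ λ₂ (suc i) (suc j)))
    ≡⟨ ∑²-cong n 𝔾-coefficient ⟩
      ∑² n (𝔾-summand F G H) ∎

  RHS-coeffBox : ∀ n → coeffBox (RHS λ₁ λ₂) n e ≡ ∑² n (RHS-summand F G H)
  RHS-coeffBox n = trans (coeffBox-∑² (RHS λ₁ λ₂) n e) (∑²-cong n RHS-coefficient)

  boundary-vanishing : ∃[ N ] ∀ n → N ℕ.≤ n →
    (∀ j → F n j ≡ 0ℤ) × (∀ i → F i n ≡ 0ℤ) × (∀ j → G n j ≡ 0ℤ) × (∀ i → H i n ≡ 0ℤ)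
  boundary-vanishing = N₁ ℕ.⊔ N₂ , λ n N≤n →
    let a-large = large-a n (ℕP.≤-trans (ℕP.m≤m⊔n N₁ N₂) N≤n)
        b-large = large-b n (ℕP.≤-trans (ℕP.m≤n⊔m N₁ N₂) N≤n)
    in (λ j → δ-two*Q-vanishesˡ {e} {a n ℚ.+ ½} (b j ℚ.+ ½) a-large)
     , (λ i → δ-two*Q-vanishesʳ {e} (a i ℚ.+ ½) {b n ℚ.+ ½} b-large)
     , (λ j → δ-two*Q-vanishesˡ {e} {a n ℚ.+ ½} (b j) a-large)
     , (λ i → δ-two*Q-vanishesʳ {e} (a i) {b n ℚ.+ ½} b-large)
    where
    N₁ N₂ : ℕ
    N₁ = proj₁ (eventually-above (1ℚ ℚ.⊔ e) λ₁)
    N₂ = proj₁ (eventually-above (1ℚ ℚ.⊔ e) λ₂)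
    large-a : ∀ n → N₁ ℕ.≤ n → 1ℚ ℚ.⊔ e ℚ.< a n ℚ.+ ½
    large-a = proj₂ (eventually-above (1ℚ ℚ.⊔ e) λ₁)
    large-b : ∀ n → N₂ ℕ.≤ n → 1ℚ ℚ.⊔ e ℚ.< b n ℚ.+ ½
    large-b = proj₂ (eventually-above (1ℚ ℚ.⊔ e) λ₂)

lemma3p5 : (λ₁ λ₂ : ℚ) → 𝔾 λ₁ λ₂ ≐ RHS λ₁ λ₂
lemma3p5 λ₁ λ₂ e = suc N , agree
  where
  open Coefficients λ₁ λ₂ e
  open ≡-Reasoning
  N : ℕ
  N = proj₁ boundary-vanishing
  agree : ∀ B → suc N ℕ.≤ B → coeffBox (𝔾 λ₁ λ₂) B e ≡ coeffBox (RHS λ₁ λ₂) B e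
  agree (suc n) (s≤s N≤n) =
    let F-row , F-col , G-row , H-col = proj₂ boundary-vanishing n N≤n
    in begin
      coeffBox (𝔾 λ₁ λ₂) (suc n) e    ≡⟨ 𝔾-coeffBox n ⟩
      ∑² n (𝔾-summand F G H)          ≡⟨ ∑²-𝔾-summand≡∑²-RHS-summand n F G H F-row F-col G-row H-col ⟩
      ∑² (suc n) (RHS-summand F G H)  ≡⟨ RHS-coeffBox (suc n) ⟨
      coeffBox (RHS λ₁ λ₂) (suc n) e  ∎
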